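{- Let $P$ be a path and let $L,L'$ be distinct list assignments for $P$ such that for every vertex $v$ of $P$ we have $L(v)\subseteq L'(v)$ and $|L'(v)|\ge 2$. Then $\mathrm{col}(P,L)<\mathrm{col}(P,L')$.
   Context: A list assignment for a graph assigns to each vertex $v$ a finite set $L(v)\subseteq\mathbb{N}$ of colors; a coloring from $L$ is a map $\gamma$ with $\gamma(v)\in L(v)$ for all $v$ and $\gamma(v)\ne\gamma(w)$ for adjacent $v,w$; $\mathrm{col}(P,L)$ is the number of such colorings. -}

module Defs where

open import Data.Nat using (ℕ; _≟_)
open import Data.Fin using (Fin)
open import Data.List using (List; []; _∷_; map; concatMap; filter; length; tabulate)
open import Data.List.Relation.Unary.Linked using (Linked; linked?)
open import Relation.Nullary using (¬_; ¬?)
open import Relation.Binary.PropositionalEquality using (_≢_)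

-- The path P on n vertices: vertices are Fin n, in order 0,1,...,n-1,
-- and i is adjacent to j iff they are consecutive.
-- A list assignment L : Fin n → List ℕ (duplicate-free lists = finite sets).
-- A colouring of P is written as the list of its values γ(0),...,γ(n-1).

choices : List (List ℕ) → List (List ℕ)
choices []       = [] ∷ []
choices (A ∷ As) = concatMap (λ a → map (a ∷_) (choices As)) A

ProperOnPath : List ℕ → Set
ProperOnPath = Linked _≢_

col : (n : ℕ) → (Fin n → List ℕ) → ℕ
col n L = length (filter (linked? (λ x y → ¬? (x ≟ y))) (choices (tabulate L)))

-- A proper L-colouring is also a proper L′-colouring, so col(P,L) ≤ col(P,L′) by counting a
-- duplicate-free list inside another.  For strictness take a vertex v and a colour c ∈ L′(v) ∖ L(v):
-- since every L′(w) has two colours, c extends greedily along the path in both directions (each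
-- vertex only has to avoid the colour of the neighbour coloured just before it) to a proper
-- L′-colouring which is not an L-colouring.
module Submission where

open import Defs
open import Data.Nat using (ℕ; zero; suc; _≤_; _<_; s≤s; _≟_)
open import Data.Fin using (Fin; zero; suc)
open import Data.Fin.Properties using (injective⇒≤; ¬∀⟶∃¬)
open import Data.List using (List; []; _∷_; _++_; map; length; lookup; filter; tabulate; cartesianProductWith)
open import Data.List.Properties using (∷-injective)
open import Data.List.Membership.Propositional using (_∈_; _∉_; find)
open import Data.List.Membership.Propositional.Properties
  using (∈-lookup; ∈-filter⁺; ∈-filter⁻; ∈-cartesianProductWith⁺; ∈-cartesianProductWith⁻)
open import Data.List.Membership.Setoid.Properties using (index-injective)
open import Data.List.Membership.DecPropositional _≟_ using (_∈?_)
open import Data.List.Relation.Binary.Pointwise using (Pointwise; []; _∷_)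
import Data.List.Relation.Binary.Pointwise as Pointwise
open import Data.List.Relation.Binary.Subset.Propositional using (_⊆_)
open import Data.List.Relation.Binary.Subset.DecPropositional _≟_ using (_⊆?_)
open import Data.List.Relation.Binary.Subset.Propositional.Properties using (filter⁺′)
open import Data.List.Relation.Unary.All using (All; []; _∷_)
import Data.List.Relation.Unary.All as All
open import Data.List.Relation.Unary.All.Properties using (¬Any⇒All¬; ¬All⇒Any¬)
  renaming (tabulate⁺ to All-tabulate⁺)
open import Data.List.Relation.Unary.Any using (here; there)
open import Data.List.Relation.Unary.AllPairs using ([]; _∷_)
open import Data.List.Relation.Unary.Linked using ([-]; _∷_; linked?)
open import Data.List.Relation.Unary.Unique.Propositional using (Unique)
import Data.List.Relation.Unary.Unique.Propositional.Properties as Unique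
open import Data.Product using (∃; ∃₂; _×_; _,_; proj₁)
open import Data.Vec.Functional using () renaming (_∷_ to _◂_)
open import Function using (id; _∘_)
open import Relation.Nullary using (¬_; ¬?; Dec; yes; no; contradiction)
open import Relation.Binary.PropositionalEquality using (_≡_; _≢_; refl; sym; cong; subst; setoid)

module _ {A : Set} where

  Unique⇒lookup-injective : ∀ {xs : List A} → Unique xs →
                            ∀ {i j} → lookup xs i ≡ lookup xs j → i ≡ j
  Unique⇒lookup-injective (_ ∷ _)    {zero}  {zero}  _ = refl
  Unique⇒lookup-injective (x∉xs ∷ u) {zero}  {suc j} e = contradiction e (All.lookup x∉xs (∈-lookup j))
  Unique⇒lookup-injective (x∉xs ∷ u) {suc i} {zero}  e = contradiction (sym e) (All.lookup x∉xs (∈-lookup i))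
  Unique⇒lookup-injective (x∉xs ∷ u) {suc i} {suc j} e = cong suc (Unique⇒lookup-injective u e)

  Unique-⊆⇒length-≤ : ∀ {xs ys : List A} → Unique xs → xs ⊆ ys → length xs ≤ length ys
  Unique-⊆⇒length-≤ u xs⊆ys = injective⇒≤ λ {i} {j} →
    Unique⇒lookup-injective u ∘ index-injective (setoid A) (xs⊆ys (∈-lookup i)) (xs⊆ys (∈-lookup j))

  Unique-⊆-∉⇒length-< : ∀ {xs ys : List A} {y} → Unique xs → xs ⊆ ys → y ∈ ys → y ∉ xs →
                        length xs < length ys
  Unique-⊆-∉⇒length-< {xs} u xs⊆ys y∈ys y∉xs =
    Unique-⊆⇒length-≤ (¬Any⇒All¬ xs y∉xs ∷ u) λ { (here refl) → y∈ys ; (there x∈xs) → xs⊆ys x∈xs }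

∃-∈-≢ : ∀ {xs : List ℕ} → Unique xs → 2 ≤ length xs → ∀ p → ∃ λ x → x ∈ xs × p ≢ x
∃-∈-≢ {x ∷ y ∷ _} (x∉ ∷ _) _ p with p ≟ x
... | no  p≢x  = x , here refl , p≢x
... | yes refl = y , there (here refl) , All.head x∉
∃-∈-≢ {_ ∷ []} _ (s≤s ()) _

∃-∈-∉ : ∀ {xs ys : List ℕ} → ¬ (xs ⊆ ys) → ∃ λ x → x ∈ xs × x ∉ ys
∃-∈-∉ {xs} {ys} xs⊈ys = find (¬All⇒Any¬ (_∈? ys) xs (xs⊈ys ∘ All.lookup))

choices-∷ : ∀ (A : List ℕ) As → choices (A ∷ As) ≡ cartesianProductWith _∷_ A (choices As)
choices-∷ []      As = refl
choices-∷ (a ∷ A) As = cong (map (a ∷_) (choices As) ++_) (choices-∷ A As)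

∈-choices⁺ : ∀ {xs As} → Pointwise _∈_ xs As → xs ∈ choices As
∈-choices⁺ []                                   = here refl
∈-choices⁺ {x ∷ xs} {A ∷ As} (x∈A ∷ xs∈As) rewrite choices-∷ A As =
  ∈-cartesianProductWith⁺ _∷_ x∈A (∈-choices⁺ xs∈As)

∈-choices⁻ : ∀ {xs} As → xs ∈ choices As → Pointwise _∈_ xs As
∈-choices⁻ []       (here refl) = []
∈-choices⁻ (A ∷ As) xs∈         rewrite choices-∷ A As
  with _ , _ , x∈A , ys∈ , refl ← ∈-cartesianProductWith⁻ _∷_ A (choices As) xs∈ =
  x∈A ∷ ∈-choices⁻ As ys∈

choices-mono : ∀ {As Bs} → Pointwise _⊆_ As Bs → choices As ⊆ choices Bs
choices-mono {As} As⊆Bs = ∈-choices⁺ ∘ (λ xs∈As → Pointwise.transitive ∈-⊆ xs∈As As⊆Bs) ∘ ∈-choices⁻ As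
  where
  ∈-⊆ : ∀ {x : ℕ} {A B} → x ∈ A → A ⊆ B → x ∈ B
  ∈-⊆ x∈A A⊆B = A⊆B x∈A

choices-unique : ∀ {As} → All Unique As → Unique (choices As)
choices-unique []                  = [] ∷ []
choices-unique {A ∷ As} (uA ∷ uAs) rewrite choices-∷ A As =
  Unique.cartesianProductWith⁺ _∷_ ∷-injective uA (choices-unique uAs)

proper? : ∀ xs → Dec (ProperOnPath xs)
proper? = linked? (λ x y → ¬? (x ≟ y))

module _ {n : ℕ} where

  colourings : (Fin n → List ℕ) → List (List ℕ)
  colourings L = filter proper? (choices (tabulate L))

  colourings-unique : ∀ {L} → (∀ v → Unique (L v)) → Unique (colourings L)
  colourings-unique uL = Unique.filter⁺ proper? (choices-unique (All-tabulate⁺ uL))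

  colourings-mono : ∀ {L L′} → (∀ v → L v ⊆ L′ v) → colourings L ⊆ colourings L′
  colourings-mono L⊆L′ = filter⁺′ proper? proper? id (choices-mono (Pointwise.tabulate⁺ L⊆L′))

  ∈-colourings⁺ : ∀ {L} {γ : Fin n → ℕ} → (∀ v → γ v ∈ L v) → ProperOnPath (tabulate γ) →
                  tabulate γ ∈ colourings L
  ∈-colourings⁺ γ∈L proper = ∈-filter⁺ proper? (∈-choices⁺ (Pointwise.tabulate⁺ γ∈L)) proper

  ∈-colourings⁻ : ∀ {L} {γ : Fin n → ℕ} → tabulate γ ∈ colourings L → ∀ v → γ v ∈ L v
  ∈-colourings⁻ {L} = Pointwise.tabulate⁻ ∘ ∈-choices⁻ (tabulate L) ∘ proj₁ ∘ ∈-filter⁻ proper?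

HasAlternatives : ∀ {n} → (Fin n → List ℕ) → Set
HasAlternatives L = ∀ v p → ∃ λ x → x ∈ L v × p ≢ x

◂-∈ : ∀ {n} {L : Fin (suc n) → List ℕ} {x δ} → x ∈ L zero → (∀ v → δ v ∈ L (suc v)) →
      ∀ v → (x ◂ δ) v ∈ L v
◂-∈ x∈L₀ δ∈L zero    = x∈L₀
◂-∈ x∈L₀ δ∈L (suc v) = δ∈L v

properColouringAfter : ∀ n (L : Fin n → List ℕ) → HasAlternatives L → ∀ p →
                       ∃ λ γ → (∀ v → γ v ∈ L v) × ProperOnPath (p ∷ tabulate γ)
properColouringAfter zero    L avoid p = (λ ()) , (λ ()) , [-]
properColouringAfter (suc n) L avoid p
  with x , x∈L₀ , p≢x ← avoid zero p
  with δ , δ∈L , proper ← properColouringAfter n (L ∘ suc) (avoid ∘ suc) x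
  = x ◂ δ , ◂-∈ x∈L₀ δ∈L , p≢x ∷ proper

properColouringThrough : ∀ n (L : Fin n → List ℕ) → HasAlternatives L → ∀ v {c} → c ∈ L v →
                         ∃ λ γ → (∀ w → γ w ∈ L w) × ProperOnPath (tabulate γ) × γ v ≡ c
properColouringThrough (suc n) L avoid zero {c} c∈L₀
  with δ , δ∈L , proper ← properColouringAfter n (L ∘ suc) (avoid ∘ suc) c
  = c ◂ δ , ◂-∈ c∈L₀ δ∈L , proper , refl
properColouringThrough (suc (suc n)) L avoid (suc v) c∈Lv
  with δ , δ∈L , proper , δv≡c ← properColouringThrough (suc n) (L ∘ suc) (avoid ∘ suc) v c∈Lv
  with x , x∈L₀ , δ₀≢x ← avoid zero (δ zero)
  = x ◂ δ , ◂-∈ x∈L₀ δ∈L , (δ₀≢x ∘ sym) ∷ proper , δv≡c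

∃-new-colour : ∀ n (L L′ : Fin n → List ℕ) → (∀ v → L v ⊆ L′ v) →
               ¬ (∀ v → (L v ⊆ L′ v) × (L′ v ⊆ L v)) → ∃₂ λ v c → c ∈ L′ v × c ∉ L v
∃-new-colour n L L′ L⊆L′ L≢L′
  with v , L′v⊈Lv ← ¬∀⟶∃¬ n (λ v → L′ v ⊆ L v) (λ v → L′ v ⊆? L v) (λ L′⊆L → L≢L′ λ v → L⊆L′ v , L′⊆L v)
  = v , ∃-∈-∉ L′v⊈Lv

mainTheorem4 : (n : ℕ) (L L′ : Fin n → List ℕ) →
    (∀ v → Unique (L v)) → (∀ v → Unique (L′ v)) →
    ¬ (∀ v → (L v ⊆ L′ v) × (L′ v ⊆ L v)) →
    (∀ v → L v ⊆ L′ v) →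
    (∀ v → 2 ≤ length (L′ v)) →
    col n L < col n L′
mainTheorem4 n L L′ uL uL′ L≢L′ L⊆L′ two
  with v , c , c∈L′v , c∉Lv ← ∃-new-colour n L L′ L⊆L′ L≢L′
  with γ , γ∈L′ , proper , γv≡c ← properColouringThrough n L′ (λ w → ∃-∈-≢ (uL′ w) (two w)) v c∈L′v
  = Unique-⊆-∉⇒length-< (colourings-unique uL) (colourings-mono L⊆L′) (∈-colourings⁺ γ∈L′ proper)
      (λ γ∈ → c∉Lv (subst (_∈ L v) γv≡c (∈-colourings⁻ γ∈ v)))
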